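{- Let $a,b,c,d$ be nonzero integers with $\gcd(a,b)=\gcd(c,d)=1$. Put $u=ac+bd$, $v=ad-bc$, and $x_{1}=a(d^{ -1})_{c}+b(d-(c^{ -1})_{d})$, $x_{2}=a(c-(d^{ -1})_{c})+b(c^{ -1})_{d}$, $x_{3}=a(d-(c^{ -1})_{d})-b(d^{ -1})_{c}$, $x_{4}=a(c^{ -1})_{d}-b(c-(d^{ -1})_{c})$, $y_{1}=c(a-(b^{ -1})_{a})+d(a^{ -1})_{b}$, $y_{2}=c(b^{ -1})_{a}+d(b-(a^{ -1})_{b})$, $y_{3}=c(b-(a^{ -1})_{b})-d(b^{ -1})_{a}$, $y_{4}=c(a^{ -1})_{b}-d(a-(b^{ -1})_{a})$. If $|u|>1$ and $|v|>1$, then $((x_i)^{ -1})_u=(y_i)_u$ for $i=1,2$, and $((x_i)^{ -1})_v=(y_i)_v$ for $i=3,4$.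
   Context: For integers $n$ and $m\ne0$, $(n)_m=n-m\lfloor n/m\rfloor$ (so $0\le (n)_m<m$ if $m>0$ and $m<(n)_m\le 0$ if $m<0$). For nonzero integers $a, m$ with $\gcd(a,m)=1$, the modular inverse $(a^{ -1})_m$ is the integer $x$ defined as follows: if $m>1$, $x$ is the unique integer with $1\le x\le m-1$ and $ax\equiv 1 \pmod m$; if $m<-1$, $x$ is the unique integer with $m+1\le x\le -1$ and $ax\equiv 1\pmod m$; if $|m|=1$, $x=\tfrac12|m|(\operatorname{sgn}(m)-\operatorname{sgn}(a))+\operatorname{sgn}(a)$. $(a^{ -1})_m$ is undefined if $am=0$ or $\gcd(a,m)\ne1$. -}

module Defs where

open import Data.Integer using (ℤ; +_; -[1+_]; _+_; _-_; _*_; -_; ∣_∣; _≤_; _<_; _%_; 0ℤ; 1ℤ; -1ℤ; sign)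
open import Data.Integer.Divisibility using (_∣_)
open import Data.Integer.GCD using (gcd)
open import Data.Nat as ℕ using (ℕ)
open import Data.Product using (_×_)
open import Data.Sum using (_⊎_)
open import Relation.Binary.PropositionalEquality using (_≡_; _≢_)

sgn : ℤ → ℤ
sgn (+ ℕ.zero)  = 0ℤ
sgn (+ ℕ.suc _) = 1ℤ
sgn -[1+ _ ]    = -1ℤ

-- The paper's (n)_m = n - m ⌊n/m⌋ for m ≠ 0.
-- For m > 0 this is the least non-negative residue; for m < 0 it lies in (m, 0].
-- (For m = 0 we return n; this case is never used.)
modP : ℤ → ℤ → ℤ
modP n (+ ℕ.zero)    = n
modP n m@(+ ℕ.suc _) = + (n % m)
modP n m@(-[1+ _ ])  = - (+ ((- n) % (- m)))

_≡_[mod_] : ℤ → ℤ → ℤ → Set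
a ≡ b [mod m ] = m ∣ (a - b)

-- IsModInv a m x : x is the modular inverse (a⁻¹)_m exactly as defined in the paper.
IsModInv : ℤ → ℤ → ℤ → Set
IsModInv a m x =
  a ≢ 0ℤ × m ≢ 0ℤ × gcd a m ≡ 1ℤ ×
  (  (+ 1 < m × (1ℤ ≤ x × x ≤ m - 1ℤ) × (a * x) ≡ 1ℤ [mod m ])
  ⊎ (m < - (+ 1) × (m + 1ℤ ≤ x × x ≤ -1ℤ) × (a * x) ≡ 1ℤ [mod m ])
  ⊎ (∣ m ∣ ≡ 1 × (+ 2) * x ≡ (+ ∣ m ∣) * (sgn m - sgn a) + (+ 2) * sgn a) )

-- The normalised inverses satisfy the reciprocity a (a⁻¹)_b + b (b⁻¹)_a - a b = 1: the left side is
-- ≡ 1 modulo the coprime numbers a and b, and the normalisation (including the convention for ∣m∣ = 1)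
-- confines a (a⁻¹)_b and b (b⁻¹)_a to the interval between 0 and a b. Polynomial identities write x_i y_i
-- as a multiple of u (resp. v) plus the product of the reciprocity defects of (a, b) and (c, d), so
-- x_i y_i ≡ 1, and the reduced residue of any inverse of x_i is its normalised inverse.
module Submission where

open import Defs
open import Data.Empty using (⊥-elim)
open import Data.Integer.Base
open import Data.Integer.Properties
open import Data.Integer.DivMod using (a≡a%n+[a/n]*n; n%d<d)
open import Data.Integer.Divisibility using (_∣_)
import Data.Integer.Divisibility.Signed as Signed
open Signed using (divides; ∣ᵤ⇒∣; ∣⇒∣ᵤ)
open import Data.Integer.Tactic.RingSolver using (solve-∀)
open import Data.Integer.GCD using (gcd; gcd[i,j]∣i; gcd[i,j]∣j)
import Data.Nat.Base as ℕ
import Data.Nat.Properties as ℕ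
import Data.Nat.Divisibility as ℕ
open import Data.Nat.Coprimality as Coprime using (Coprime; coprime-divisor; gcd≡1⇒coprime)
open import Data.Product using (_×_; _,_)
open import Data.Sum using (_⊎_; inj₁; inj₂)
open import Function using (_∘_)
open import Relation.Nullary using (¬_)
open import Relation.Binary.PropositionalEquality

private
  variable
    a b m n x y A B : ℤ

m∤-1 : 1 ℕ.< ∣ m ∣ → ¬ (m ∣ -1ℤ)
m∤-1 1<∣m∣ m∣-1 = ℕ.<⇒≢ 1<∣m∣ (sym (ℕ.∣1⇒≡1 m∣-1))

invertible⇒coprime : (x * y) ≡ 1ℤ [mod m ] → gcd x m ≡ 1ℤ
invertible⇒coprime {x} {y} {m} xy≡1 = cong +_ (ℕ.∣1⇒≡1 (∣⇒∣ᵤ g∣-1))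
  where
  g∣x : gcd x m Signed.∣ x
  g∣x = ∣ᵤ⇒∣ (gcd[i,j]∣i x m)
  g∣m : gcd x m Signed.∣ m
  g∣m = ∣ᵤ⇒∣ (gcd[i,j]∣j x m)
  g∣-1 : gcd x m Signed.∣ -1ℤ
  g∣-1 = Signed.∣m+n∣m⇒∣n (Signed.∣-trans g∣m (∣ᵤ⇒∣ xy≡1)) (Signed.∣m⇒∣m*n y g∣x)

modP-congruent : ∀ y m → m Signed.∣ modP y m - y
modP-congruent y +0 = divides 0ℤ (+-inverseʳ y)
modP-congruent y m@(+[1+ _ ]) = divides (- (y / m)) (begin
  + (y % m) - y                          ≡⟨ cong (λ z → + (y % m) - z) (a≡a%n+[a/n]*n y m) ⟩
  + (y % m) - (+ (y % m) + (y / m) * m)  ≡⟨ regroup (+ (y % m)) (y / m) m ⟩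
  - (y / m) * m                          ∎)
  where
  open ≡-Reasoning
  regroup : ∀ r q m → r - (r + q * m) ≡ (- q) * m
  regroup = solve-∀
modP-congruent y m@(-[1+ _ ]) = divides (- ((- y) / (- m))) (begin
  - + r - y                    ≡⟨ cong (λ z → - + r + z) (a≡a%n+[a/n]*n (- y) (- m)) ⟩
  - + r + (+ r + q * (- m))    ≡⟨ regroup (+ r) q m ⟩
  - q * m                      ∎)
  where
  open ≡-Reasoning
  r = (- y) % (- m)
  q = (- y) / (- m)
  regroup : ∀ r q m → - r + (r + q * (- m)) ≡ (- q) * m
  regroup = solve-∀

-- Stated in the shape of the last component of IsModInv; its third alternative never occurs here.
modP-range : 1 ℕ.< ∣ m ∣ → modP y m ≢ 0ℤ → (x * modP y m) ≡ 1ℤ [mod m ] →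
  (+ 1 < m × (1ℤ ≤ modP y m × modP y m ≤ m - 1ℤ) × (x * modP y m) ≡ 1ℤ [mod m ]) ⊎
  (m < - (+ 1) × (m + 1ℤ ≤ modP y m × modP y m ≤ -1ℤ) × (x * modP y m) ≡ 1ℤ [mod m ]) ⊎
  (∣ m ∣ ≡ 1 × + 2 * modP y m ≡ + ∣ m ∣ * (sgn m - sgn x) + + 2 * sgn x)
modP-range {+0} ()
modP-range {+[1+ 0 ]} (ℕ.s≤s ())
modP-range {m@(+[1+ ℕ.suc _ ])} {y} _ r≢0 xr≡1 =
  inj₁ (+<+ (ℕ.s≤s (ℕ.s≤s ℕ.z≤n)) ,
        (+≤+ (ℕ.n≢0⇒n>0 (r≢0 ∘ cong (+_))) , +≤+ (ℕ.≤-pred (n%d<d y m))) , xr≡1)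
modP-range { -[1+ 0 ]} (ℕ.s≤s ())
modP-range {m@(-[1+ ℕ.suc _ ])} {y} _ r≢0 xr≡1 =
  inj₂ (inj₁ (-<- (ℕ.s≤s ℕ.z≤n) ,
              (neg-mono-≤ (+≤+ (ℕ.≤-pred (n%d<d (- y) (- m)))) ,
               neg-mono-≤ (+≤+ (ℕ.n≢0⇒n>0 (r≢0 ∘ cong (-_ ∘ +_))))) ,
              xr≡1))

modP-isModInv : 1 ℕ.< ∣ m ∣ → (x * y) ≡ 1ℤ [mod m ] → IsModInv x m (modP y m)
modP-isModInv {m} {x} {y} 1<∣m∣ xy≡1 =
  x≢0 , m≢0 , invertible⇒coprime {x} {y} {m} xy≡1 , modP-range {m} {y} {x} 1<∣m∣ r≢0 xr≡1
  where
  r = modP y m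
  xr≡1 : (x * r) ≡ 1ℤ [mod m ]
  xr≡1 = ∣⇒∣ᵤ (subst (m Signed.∣_) (split x r y)
           (Signed.∣m∣n⇒∣m+n (Signed.∣n⇒∣m*n x (modP-congruent y m)) (∣ᵤ⇒∣ xy≡1)))
    where
    split : ∀ x r y → x * (r - y) + (x * y - 1ℤ) ≡ x * r - 1ℤ
    split = solve-∀
  r≢0 : r ≢ 0ℤ
  r≢0 r≡0 = m∤-1 {m} 1<∣m∣
    (subst (λ z → m ∣ z - 1ℤ) (*-zeroʳ x) (subst (λ z → m ∣ x * z - 1ℤ) r≡0 xr≡1))
  x≢0 : x ≢ 0ℤ
  x≢0 refl = m∤-1 {m} 1<∣m∣ xy≡1
  m≢0 : m ≢ 0ℤ
  m≢0 m≡0 = ℕ.<⇒≱ 1<∣m∣ (subst (λ z → ∣ z ∣ ℕ.≤ 1) (sym m≡0) ℕ.z≤n)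

modInv-congruent : IsModInv a m A → (a * A) ≡ 1ℤ [mod m ]
modInv-congruent (_ , _ , _ , inj₁ (_ , _ , aA≡1)) = aA≡1
modInv-congruent (_ , _ , _ , inj₂ (inj₁ (_ , _ , aA≡1))) = aA≡1
modInv-congruent {a} {m} {A} (_ , _ , _ , inj₂ (inj₂ (∣m∣≡1 , _))) =
  subst (ℕ._∣ ∣ a * A - 1ℤ ∣) (sym ∣m∣≡1) (ℕ.1∣ _)

coprime-∣-∣⇒*∣ : ∀ {m n k} → Coprime m n → m ℕ.∣ k → n ℕ.∣ k → m ℕ.* n ℕ.∣ k
coprime-∣-∣⇒*∣ {m} {n} c (ℕ.divides q refl) n∣qm =
  subst (ℕ._∣ q ℕ.* m) (ℕ.*-comm n m) (ℕ.*-monoˡ-∣ m n∣q)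
  where
  n∣q : n ℕ.∣ q
  n∣q = coprime-divisor (Coprime.sym c) (subst (n ℕ.∣_) (ℕ.*-comm q m) n∣qm)

gcd≡1-∣-∣⇒*∣ : gcd a b ≡ 1ℤ → a ∣ x → b ∣ x → a * b ∣ x
gcd≡1-∣-∣⇒*∣ {a} {b} {x} g≡1 a∣x b∣x =
  subst (ℕ._∣ ∣ x ∣) (sym (abs-* a b)) (coprime-∣-∣⇒*∣ (gcd≡1⇒coprime (+-injective g≡1)) a∣x b∣x)

-- Modulo a the left side is b B, modulo b it is a A.
modInv-reciprocity-congruent : IsModInv a b A → IsModInv b a B →
  (a * A + b * B - a * b) ≡ 1ℤ [mod a * b ]
modInv-reciprocity-congruent {a} {b} {A} {B} invA@(_ , _ , gcd≡1 , _) invB =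
  gcd≡1-∣-∣⇒*∣ {a} {b} {a * A + b * B - a * b - 1ℤ} gcd≡1
    (subst (a ∣_) (splitᵃ a b A B) (≡1[mod]⇒∣-1+* a (b * B) (A - b) (modInv-congruent {b} {a} {B} invB)))
    (subst (b ∣_) (splitᵇ a b A B) (≡1[mod]⇒∣-1+* b (a * A) (B - a) (modInv-congruent {a} {b} {A} invA)))
  where
  splitᵃ : ∀ a b A B → (b * B - 1ℤ) + a * (A - b) ≡ a * A + b * B - a * b - 1ℤ
  splitᵃ = solve-∀
  splitᵇ : ∀ a b A B → (a * A - 1ℤ) + b * (B - a) ≡ a * A + b * B - a * b - 1ℤ
  splitᵇ = solve-∀
  ≡1[mod]⇒∣-1+* : ∀ p e k → e ≡ 1ℤ [mod p ] → p ∣ (e - 1ℤ) + p * k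
  ≡1[mod]⇒∣-1+* p e k p∣e-1 =
    ∣⇒∣ᵤ (Signed.∣m∣n⇒∣m+n (∣ᵤ⇒∣ {p} {e - 1ℤ} p∣e-1) (Signed.∣m⇒∣m*n k (Signed.∣-refl {p})))

infix 4 _∈⟨0,_⟩ _∈⟨0,_]

_∈⟨0,_⟩ : ℤ → ℤ → Set
x ∈⟨0, n ⟩ = (0ℤ < x × x < n) ⊎ (n < x × x < 0ℤ)

_∈⟨0,_] : ℤ → ℤ → Set
x ∈⟨0, n ] = (0ℤ < x × x ≤ n) ⊎ (n < x × x ≤ 0ℤ)

∈⟨0,⟩⇒∈⟨0,] : x ∈⟨0, n ⟩ → x ∈⟨0, n ]
∈⟨0,⟩⇒∈⟨0,] (inj₁ (0<x , x<n)) = inj₁ (0<x , <⇒≤ x<n)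
∈⟨0,⟩⇒∈⟨0,] (inj₂ (n<x , x<0)) = inj₂ (n<x , <⇒≤ x<0)

*-monoˡ-∈⟨0,⟩ : a ≢ 0ℤ → x ∈⟨0, n ⟩ → a * x ∈⟨0, a * n ⟩
*-monoˡ-∈⟨0,⟩ {+0} a≢0 _ = ⊥-elim (a≢0 refl)
*-monoˡ-∈⟨0,⟩ {a@(+[1+ _ ])} {x} _ (inj₁ (0<x , x<n)) =
  inj₁ (subst (_< a * x) (*-zeroʳ a) (*-monoˡ-<-pos a 0<x) , *-monoˡ-<-pos a x<n)
*-monoˡ-∈⟨0,⟩ {a@(+[1+ _ ])} {x} _ (inj₂ (n<x , x<0)) =
  inj₂ (*-monoˡ-<-pos a n<x , subst (a * x <_) (*-zeroʳ a) (*-monoˡ-<-pos a x<0))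
*-monoˡ-∈⟨0,⟩ {a@(-[1+ _ ])} {x} _ (inj₁ (0<x , x<n)) =
  inj₂ (*-monoˡ-<-neg a x<n , subst (a * x <_) (*-zeroʳ a) (*-monoˡ-<-neg a 0<x))
*-monoˡ-∈⟨0,⟩ {a@(-[1+ _ ])} {x} _ (inj₂ (n<x , x<0)) =
  inj₁ (subst (_< a * x) (*-zeroʳ a) (*-monoˡ-<-neg a x<0) , *-monoˡ-<-neg a n<x)

-- For ∣ b ∣ ≡ 1 the paper's convention makes A = b when a and b have the same sign, and A = 0 otherwise.
modInv-unit-∈⟨0,] : a ≢ 0ℤ → ∣ b ∣ ≡ 1 → + 2 * A ≡ + ∣ b ∣ * (sgn b - sgn a) + + 2 * sgn a →
  a * A ∈⟨0, a * b ]
modInv-unit-∈⟨0,] {+0} a≢0 _ _ = ⊥-elim (a≢0 refl)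
modInv-unit-∈⟨0,] {b = +0} _ ()
modInv-unit-∈⟨0,] {b = +[1+ ℕ.suc _ ]} _ ()
modInv-unit-∈⟨0,] {b = -[1+ ℕ.suc _ ]} _ ()
modInv-unit-∈⟨0,] {a@(+[1+ _ ])} {+[1+ 0 ]} {A} _ _ 2A≡2
  rewrite *-cancelˡ-≡ (+ 2) A 1ℤ 2A≡2 = inj₁ (+<+ (ℕ.s≤s ℕ.z≤n) , ≤-refl)
modInv-unit-∈⟨0,] {a@(+[1+ _ ])} { -[1+ 0 ]} {A} _ _ 2A≡0
  rewrite *-cancelˡ-≡ (+ 2) A 0ℤ 2A≡0 | *-zeroʳ a = inj₂ (-<+ , ≤-refl)
modInv-unit-∈⟨0,] {a@(-[1+ _ ])} {+[1+ 0 ]} {A} _ _ 2A≡0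
  rewrite *-cancelˡ-≡ (+ 2) A 0ℤ 2A≡0 | *-zeroʳ a = inj₂ (-<+ , ≤-refl)
modInv-unit-∈⟨0,] {a@(-[1+ _ ])} { -[1+ 0 ]} {A} _ _ 2A≡-2
  rewrite *-cancelˡ-≡ (+ 2) A -1ℤ 2A≡-2 = inj₁ (+<+ (ℕ.s≤s ℕ.z≤n) , ≤-refl)

modInv-∈⟨0,] : IsModInv a b A → a * A ∈⟨0, a * b ]
modInv-∈⟨0,] {b = b} (a≢0 , _ , _ , inj₁ (_ , (1≤A , A≤b-1) , _)) =
  ∈⟨0,⟩⇒∈⟨0,] (*-monoˡ-∈⟨0,⟩ a≢0
    (inj₁ (suc[i]≤j⇒i<j 1≤A , i≤pred[j]⇒i<j (subst (_ ≤_) (+-comm b -1ℤ) A≤b-1))))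
modInv-∈⟨0,] {b = b} (a≢0 , _ , _ , inj₂ (inj₁ (_ , (b+1≤A , A≤-1) , _))) =
  ∈⟨0,⟩⇒∈⟨0,] (*-monoˡ-∈⟨0,⟩ a≢0
    (inj₂ (suc[i]≤j⇒i<j (subst (_≤ _) (+-comm b 1ℤ) b+1≤A) , ≤-<-trans A≤-1 -<+)))
modInv-∈⟨0,] (a≢0 , _ , _ , inj₂ (inj₂ (∣b∣≡1 , 2A≡))) = modInv-unit-∈⟨0,] a≢0 ∣b∣≡1 2A≡

∈⟨0,]⇒+-1∈⟨0,n+n⟩ : x ∈⟨0, n ] → y ∈⟨0, n ] → x + y - 1ℤ ∈⟨0, n + n ⟩
∈⟨0,]⇒+-1∈⟨0,n+n⟩ {x} {n} {y} (inj₁ (0<x , x≤n)) (inj₁ (0<y , y≤n)) =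
  inj₁ (+-monoˡ-< -1ℤ (+-mono-≤-< (i<j⇒suc[i]≤j 0<x) 0<y) ,
        <-≤-trans (i-1<i (x + y)) (+-mono-≤ x≤n y≤n))
  where
  i-1<i : ∀ i → i - 1ℤ < i
  i-1<i i = subst (i - 1ℤ <_) (+-identityʳ i) (+-monoʳ-< i -<+)
∈⟨0,]⇒+-1∈⟨0,n+n⟩ {x} {n} {y} (inj₂ (n<x , x≤0)) (inj₂ (n<y , y≤0)) =
  inj₂ (subst (_< x + y - 1ℤ) (1+n+n-1≡n+n n) (+-monoˡ-< -1ℤ (+-mono-≤-< (i<j⇒suc[i]≤j n<x) n<y)) ,
        ≤-<-trans (+-monoˡ-≤ -1ℤ (+-mono-≤ x≤0 y≤0)) -<+)
  where
  1+n+n-1≡n+n : ∀ n → 1ℤ + n + n - 1ℤ ≡ n + n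
  1+n+n-1≡n+n = solve-∀
∈⟨0,]⇒+-1∈⟨0,n+n⟩ (inj₁ (0<x , x≤n)) (inj₂ (n<y , y≤0)) =
  ⊥-elim (<-asym (<-≤-trans 0<x x≤n) (<-≤-trans n<y y≤0))
∈⟨0,]⇒+-1∈⟨0,n+n⟩ (inj₂ (n<x , x≤0)) (inj₁ (0<y , y≤n)) =
  ⊥-elim (<-asym (<-≤-trans 0<y y≤n) (<-≤-trans n<x x≤0))

0<x<2⇒x≡1 : 0ℤ < x → x < + 2 → x ≡ 1ℤ
0<x<2⇒x≡1 {+[1+ 0 ]} _ _ = refl
0<x<2⇒x≡1 {+0} (+<+ ())
0<x<2⇒x≡1 {+[1+ ℕ.suc _ ]} _ (+<+ (ℕ.s≤s (ℕ.s≤s ())))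

∣∧0<x<n+n⇒x≡n : n Signed.∣ x → 0ℤ < x → x < n + n → x ≡ n
∣∧0<x<n+n⇒x≡n {+0} _ 0<x x<0 = ⊥-elim (<-asym 0<x x<0)
∣∧0<x<n+n⇒x≡n { -[1+ _ ]} _ 0<x x<n+n = ⊥-elim (<-asym 0<x (<-trans x<n+n -<+))
∣∧0<x<n+n⇒x≡n {n@(+[1+ _ ])} (divides q refl) 0<qn qn<n+n = begin
  q * n   ≡⟨ cong (_* n) (0<x<2⇒x≡1 0<q q<2) ⟩
  1ℤ * n  ≡⟨ *-identityˡ n ⟩
  n       ∎
  where
  open ≡-Reasoning
  0<q : 0ℤ < q
  0<q = *-cancelʳ-<-nonNeg n 0<qn
  q<2 : q < + 2
  q<2 = *-cancelʳ-<-nonNeg n (subst (q * n <_) (double n) qn<n+n)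
    where
    double : ∀ n → n + n ≡ + 2 * n
    double = solve-∀

∣∧∈⟨0,n+n⟩⇒≡ : n Signed.∣ x → x ∈⟨0, n + n ⟩ → x ≡ n
∣∧∈⟨0,n+n⟩⇒≡ n∣x (inj₁ (0<x , x<n+n)) = ∣∧0<x<n+n⇒x≡n n∣x 0<x x<n+n
∣∧∈⟨0,n+n⟩⇒≡ {n} {x} (divides q x≡qn) (inj₂ (n+n<x , x<0)) =
  neg-injective (∣∧0<x<n+n⇒x≡n (divides q (trans (cong -_ x≡qn) (neg-distribʳ-* q n)))
                               (neg-mono-< x<0)
                               (subst (- x <_) (neg-distrib-+ n n) (neg-mono-< n+n<x)))

-- a A + b B - 1 lies in ⟨0, 2 a b⟩ and is ≡ a b modulo a b.
modInv-reciprocity : IsModInv a b A → IsModInv b a B → a * A + b * B - a * b ≡ 1ℤ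
modInv-reciprocity {a} {b} {A} {B} invA invB = begin
  s - a * b         ≡⟨ cong (λ t → s - t) (sym s-1≡ab) ⟩
  s - (s - 1ℤ)      ≡⟨ s-[s-1]≡1 s ⟩
  1ℤ                ∎
  where
  open ≡-Reasoning
  s = a * A + b * B
  s-[s-1]≡1 : ∀ s → s - (s - 1ℤ) ≡ 1ℤ
  s-[s-1]≡1 = solve-∀
  ab∣s-1 : a * b Signed.∣ s - 1ℤ
  ab∣s-1 = subst (a * b Signed.∣_) (shift s (a * b))
    (Signed.∣m∣n⇒∣m+n
      (∣ᵤ⇒∣ {a * b} {s - a * b - 1ℤ} (modInv-reciprocity-congruent {a} {b} {A} {B} invA invB))
      (Signed.∣-refl {a * b}))
    where
    shift : ∀ s n → s - n - 1ℤ + n ≡ s - 1ℤ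
    shift = solve-∀
  s-1≡ab : s - 1ℤ ≡ a * b
  s-1≡ab = ∣∧∈⟨0,n+n⟩⇒≡ ab∣s-1 (∈⟨0,]⇒+-1∈⟨0,n+n⟩ (modInv-∈⟨0,] {a} {b} {A} invA)
    (subst (b * B ∈⟨0,_]) (*-comm b a) (modInv-∈⟨0,] {b} {a} {B} invB)))

≡1[mod]-from : ∀ t m q {r s} → t ≡ m * q + r * s → r ≡ 1ℤ → s ≡ 1ℤ → t ≡ 1ℤ [mod m ]
≡1[mod]-from t m q t≡ refl refl = ∣⇒∣ᵤ (divides q (begin
  t - 1ℤ                  ≡⟨ cong (_- 1ℤ) t≡ ⟩
  m * q + 1ℤ * 1ℤ - 1ℤ    ≡⟨ regroup m q ⟩
  q * m                   ∎))
  where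
  open ≡-Reasoning
  regroup : ∀ m q → m * q + 1ℤ * 1ℤ - 1ℤ ≡ q * m
  regroup = solve-∀

module _ (a b c d A B C D : ℤ)
         (abReciprocity : a * A + b * B - a * b ≡ 1ℤ) (cdReciprocity : c * C + d * D - c * d ≡ 1ℤ) where

  x₁y₁≡1[mod-u] : ((a * D + b * (d - C)) * (c * (a - B) + d * A)) ≡ 1ℤ [mod a * c + b * d ]
  x₁y₁≡1[mod-u] = ≡1[mod]-from _ (a * c + b * d) (D * (a - B) + A * (d - C))
    (identity a b c d A B C D) abReciprocity cdReciprocity
    where
    identity : ∀ a b c d A B C D → (a * D + b * (d - C)) * (c * (a - B) + d * A) ≡
      (a * c + b * d) * (D * (a - B) + A * (d - C)) + (a * A + b * B - a * b) * (c * C + d * D - c * d)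
    identity = solve-∀

  x₂y₂≡1[mod-u] : ((a * (c - D) + b * C) * (c * B + d * (b - A))) ≡ 1ℤ [mod a * c + b * d ]
  x₂y₂≡1[mod-u] = ≡1[mod]-from _ (a * c + b * d) ((c - D) * B + C * (b - A))
    (identity a b c d A B C D) abReciprocity cdReciprocity
    where
    identity : ∀ a b c d A B C D → (a * (c - D) + b * C) * (c * B + d * (b - A)) ≡
      (a * c + b * d) * ((c - D) * B + C * (b - A)) + (a * A + b * B - a * b) * (c * C + d * D - c * d)
    identity = solve-∀

  x₃y₃≡1[mod-v] : ((a * (d - C) - b * D) * (c * (b - A) - d * B)) ≡ 1ℤ [mod a * d - b * c ]
  x₃y₃≡1[mod-v] = ≡1[mod]-from _ (a * d - b * c) (D * (b - A) - B * (d - C))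
    (identity a b c d A B C D) abReciprocity cdReciprocity
    where
    identity : ∀ a b c d A B C D → (a * (d - C) - b * D) * (c * (b - A) - d * B) ≡
      (a * d - b * c) * (D * (b - A) - B * (d - C)) + (a * A + b * B - a * b) * (c * C + d * D - c * d)
    identity = solve-∀

  x₄y₄≡1[mod-v] : ((a * C - b * (c - D)) * (c * A - d * (a - B))) ≡ 1ℤ [mod a * d - b * c ]
  x₄y₄≡1[mod-v] = ≡1[mod]-from _ (a * d - b * c) (A * (c - D) - C * (a - B))
    (identity a b c d A B C D) abReciprocity cdReciprocity
    where
    identity : ∀ a b c d A B C D → (a * C - b * (c - D)) * (c * A - d * (a - B)) ≡
      (a * d - b * c) * (A * (c - D) - C * (a - B)) + (a * A + b * B - a * b) * (c * C + d * D - c * d)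
    identity = solve-∀

corollary4p4 :
    (a b c d : ℤ) → a ≢ 0ℤ → b ≢ 0ℤ → c ≢ 0ℤ → d ≢ 0ℤ →
    gcd a b ≡ 1ℤ → gcd c d ≡ 1ℤ →
    (ainv binv cinv dinv : ℤ) →
    IsModInv a b ainv → IsModInv b a binv → IsModInv c d cinv → IsModInv d c dinv →
    let u = a * c + b * d
        v = a * d - b * c
        x₁ = a * dinv + b * (d - cinv)
        x₂ = a * (c - dinv) + b * cinv
        x₃ = a * (d - cinv) - b * dinv
        x₄ = a * cinv - b * (c - dinv)
        y₁ = c * (a - binv) + d * ainv
        y₂ = c * binv + d * (b - ainv)
        y₃ = c * (b - ainv) - d * binv
        y₄ = c * ainv - d * (a - binv)
    in 1 ℕ.< ∣ u ∣ → 1 ℕ.< ∣ v ∣ →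
       IsModInv x₁ u (modP y₁ u) × IsModInv x₂ u (modP y₂ u) ×
       IsModInv x₃ v (modP y₃ v) × IsModInv x₄ v (modP y₄ v)
corollary4p4 a b c d _ _ _ _ _ _ A B C D invA invB invC invD 1<∣u∣ 1<∣v∣ =
    modP-isModInv 1<∣u∣ (x₁y₁≡1[mod-u] a b c d A B C D abReciprocity cdReciprocity)
  , modP-isModInv 1<∣u∣ (x₂y₂≡1[mod-u] a b c d A B C D abReciprocity cdReciprocity)
  , modP-isModInv 1<∣v∣ (x₃y₃≡1[mod-v] a b c d A B C D abReciprocity cdReciprocity)
  , modP-isModInv 1<∣v∣ (x₄y₄≡1[mod-v] a b c d A B C D abReciprocity cdReciprocity)
  where
  abReciprocity : a * A + b * B - a * b ≡ 1ℤ
  abReciprocity = modInv-reciprocity {a} {b} {A} {B} invA invB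
  cdReciprocity : c * C + d * D - c * d ≡ 1ℤ
  cdReciprocity = modInv-reciprocity {c} {d} {C} {D} invC invD
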